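{- Let $\mathbb K$ be a field of characteristic zero, $R=\mathbb K[x,y,z]$, and let $\mathcal A$ be an essential line arrangement in $\mathbb P^2$ defined by pairwise non-proportional linear forms $\ell_1=x,\ell_2=y,\ell_3=z,\ell_i=\alpha_ix+\beta_iy+\gamma_iz$ ($i\ge 4$). Assume that every logarithmic derivation of $\mathcal A$ of degree $1$ is a scalar multiple of the Euler derivation $\theta_E=x\partial_x+y\partial_y+z\partial_z$, and let $\theta=xL_1\partial_x+yL_2\partial_y+zL_3\partial_z$ be a logarithmic derivation of $\mathcal A$ of degree $2$ which is not of the form $L\theta_E$ with $L$ a linear form, where $xL_1,yL_2,zL_3$ have no common divisor and $L_1=b_{1,1}x+b_{2,1}y+b_{3,1}z$, $L_2=b_{1,2}x+b_{2,2}y+b_{3,2}z$, $L_3=b_{1,3}x+b_{2,3}y+b_{3,3}z$. Set $a_1=b_{2,1}-b_{2,2}$, $b_1=b_{1,2}-b_{1,1}$, $a_2=b_{3,1}-b_{3,3}$, $c_2=b_{1,3}-b_{1,1}$, $b_3=b_{3,2}-b_{3,3}$, $c_3=b_{2,3}-b_{2,2}$, and $$I_{xy}=\langle a_1x+b_1y,\ y(a_2x+c_2z)-x(b_3y+c_3z)\rangle,$$ $$I_{xz}=\langle a_2x+c_2z,\ z(a_1x+b_1y)-x(b_3y+c_3z)\rangle,$$ $$I_{yz}=\langle b_3y+c_3z,\ z(a_1x+b_1y)-y(a_2x+c_2z)\rangle.$$ Then none of $I_{xy},I_{xz},I_{yz}$ is the zero ideal.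
   Context: A logarithmic derivation of $\mathcal A$ is a $\mathbb K$-derivation $\theta=P_1\partial_x+P_2\partial_y+P_3\partial_z$ with $P_i$ homogeneous of a common degree (the degree of $\theta$) such that $\theta(\ell_i)\in\langle\ell_i\rangle$ for every defining form $\ell_i$. Logarithmic derivations that are not multiples of $\theta_E$ correspond to syzygies on the Jacobian ideal $\langle F_x,F_y,F_z\rangle$, where $F=\prod\ell_i$; the hypotheses say that the Jacobian ideal has no linear syzygy and $\theta$ corresponds to a minimal quadratic syzygy. -}

module Defs where

open import Level using (Level; _⊔_; suc)
open import Algebra.Bundles using (CommutativeRing)
open import Data.Nat using (ℕ; zero; _<_) renaming (suc to 1+; _+_ to _+ℕ_; _∸_ to _∸_)
open import Data.Fin using (Fin) renaming (zero to f0; suc to fs)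
open import Data.Product using (Σ; ∃; _×_; _,_)
open import Data.Sum using (_⊎_)
open import Relation.Binary.PropositionalEquality using (_≡_; _≢_)
open import Relation.Nullary using (¬_)

record Field (c ℓ : Level) : Set (Level.suc (c ⊔ ℓ)) where
  field
    commutativeRing : CommutativeRing c ℓ
  open CommutativeRing commutativeRing public
  field
    1≉0     : ¬ (1# ≈ 0#)
    inverse : ∀ x → ¬ (x ≈ 0#) → Σ Carrier λ y → (x * y) ≈ 1#

module FieldDefs {c ℓ : Level} (K : Field c ℓ) where
  open Field K

  _·1 : ℕ → Carrier
  zero ·1 = 0#
  1+ n ·1 = 1# + (n ·1)

  CharZero : Set ℓ
  CharZero = ∀ n → ¬ ((1+ n ·1) ≈ 0#)

  -- Elements of K[[x,y,z]] as coefficient functions: f i j k is the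
  -- coefficient of x^i y^j z^k.  Polynomials (R = K[x,y,z]) are those
  -- with finite support (IsPoly).

  Series : Set c
  Series = ℕ → ℕ → ℕ → Carrier

  IsPoly : Series → Set ℓ
  IsPoly f = Σ ℕ λ N → ∀ i j k → N < i +ℕ j +ℕ k → f i j k ≈ 0#

  -- homogeneous of degree d (this also implies IsPoly)
  IsHomog : ℕ → Series → Set ℓ
  IsHomog d f = ∀ i j k → ¬ (i +ℕ j +ℕ k ≡ d) → f i j k ≈ 0#

  _≈ₚ_ : Series → Series → Set ℓ
  f ≈ₚ g = ∀ i j k → f i j k ≈ g i j k

  0ₚ : Series
  0ₚ _ _ _ = 0#

  _+ₚ_ : Series → Series → Series
  (f +ₚ g) i j k = f i j k + g i j k

  -ₚ_ : Series → Series
  (-ₚ f) i j k = - f i j k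

  _-ₚ_ : Series → Series → Series
  f -ₚ g = f +ₚ (-ₚ g)

  _·ₚ_ : Carrier → Series → Series
  (a ·ₚ f) i j k = a * f i j k

  Σ≤ : ℕ → (ℕ → Carrier) → Carrier
  Σ≤ zero   f = f 0
  Σ≤ (1+ n) f = Σ≤ n f + f (1+ n)

  _*ₚ_ : Series → Series → Series
  (f *ₚ g) i j k =
    Σ≤ i λ a → Σ≤ j λ b → Σ≤ k λ e → f a b e * g (i ∸ a) (j ∸ b) (k ∸ e)

  X Y Z : Series
  X 1 0 0 = 1#
  X _ _ _ = 0#
  Y 0 1 0 = 1#
  Y _ _ _ = 0#
  Z 0 0 1 = 1#
  Z _ _ _ = 0#

  lin : Carrier → Carrier → Carrier → Series
  lin α β γ = ((α ·ₚ X) +ₚ (β ·ₚ Y)) +ₚ (γ ·ₚ Z)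

  _∣ₚ_ : Series → Series → Set (c ⊔ ℓ)
  d ∣ₚ f = Σ Series λ q → IsPoly q × (f ≈ₚ (d *ₚ q))

  NonConstant : Series → Set ℓ
  NonConstant f = IsPoly f × (∃ λ i → ∃ λ j → ∃ λ k →
                    ¬ (i +ℕ j +ℕ k ≡ 0) × ¬ (f i j k ≈ 0#))

  _∈⟨_,_⟩ : Series → Series → Series → Set (c ⊔ ℓ)
  h ∈⟨ f , g ⟩ = Σ Series λ r → Σ Series λ s →
                   IsPoly r × IsPoly s × (h ≈ₚ ((r *ₚ f) +ₚ (s *ₚ g)))

  IsZeroIdeal⟨_,_⟩ : Series → Series → Set (c ⊔ ℓ)
  IsZeroIdeal⟨ f , g ⟩ = ∀ h → IsPoly h → h ∈⟨ f , g ⟩ → h ≈ₚ 0ₚ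

  Form : Set c
  Form = Carrier × Carrier × Carrier

  forms : ∀ {m} → (Fin m → Form) → Fin (3 +ℕ m) → Form
  forms rest f0                = (1# , 0# , 0#)
  forms rest (fs f0)           = (0# , 1# , 0#)
  forms rest (fs (fs f0))      = (0# , 0# , 1#)
  forms rest (fs (fs (fs i)))  = rest i

  Proportional : Form → Form → Set (c ⊔ ℓ)
  Proportional (a , b , e) (a' , b' , e') =
    Σ Carrier λ t → (a ≈ t * a') × (b ≈ t * b') × (e ≈ t * e')

  PairwiseNonProportional : ∀ {n} → (Fin n → Form) → Set (c ⊔ ℓ)
  PairwiseNonProportional ℓs = ∀ i j → i ≢ j → ¬ Proportional (ℓs i) (ℓs j)

  formPoly : Form → Series
  formPoly (a , b , e) = lin a b e

  -- a derivation P₁∂x + P₂∂y + P₃∂z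
  Derivation : Set c
  Derivation = Series × Series × Series

  applyLin : Derivation → Form → Series
  applyLin (P₁ , P₂ , P₃) (a , b , e) = ((a ·ₚ P₁) +ₚ (b ·ₚ P₂)) +ₚ (e ·ₚ P₃)

  HomogDer : ℕ → Derivation → Set ℓ
  HomogDer d (P₁ , P₂ , P₃) = IsHomog d P₁ × IsHomog d P₂ × IsHomog d P₃

  IsLogarithmic : ∀ {n} → (Fin n → Form) → Derivation → Set (c ⊔ ℓ)
  IsLogarithmic ℓs θ = ∀ i → formPoly (ℓs i) ∣ₚ applyLin θ (ℓs i)

  LogDer : ∀ {n} → (Fin n → Form) → ℕ → Derivation → Set (c ⊔ ℓ)
  LogDer ℓs d θ = HomogDer d θ × IsLogarithmic ℓs θ

  θE : Derivation
  θE = (X , Y , Z)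

  _≈ᵈ_ : Derivation → Derivation → Set ℓ
  (P₁ , P₂ , P₃) ≈ᵈ (Q₁ , Q₂ , Q₃) = (P₁ ≈ₚ Q₁) × (P₂ ≈ₚ Q₂) × (P₃ ≈ₚ Q₃)

  _·ᵈ_ : Series → Derivation → Derivation
  L ·ᵈ (P₁ , P₂ , P₃) = (L *ₚ P₁ , L *ₚ P₂ , L *ₚ P₃)

  _⋆ᵈ_ : Carrier → Derivation → Derivation
  t ⋆ᵈ (P₁ , P₂ , P₃) = (t ·ₚ P₁ , t ·ₚ P₂ , t ·ₚ P₃)

  IsLinearForm : Series → Set (c ⊔ ℓ)
  IsLinearForm L = Σ Form λ φ → L ≈ₚ formPoly φ

module Submission where

-- Suppose I_xy = 0.  Then both of its generators vanish, and comparing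
-- coefficients gives five linear relations between the b_{i,j}; they say
-- precisely that θ = L₁θ_E + δ z²∂z with δ = b₃₃ - b₃₁.  If δ = 0, θ is a
-- linear multiple of θ_E, which is excluded.  If δ ≠ 0, let ℓ = αx+βy+γz be
-- a defining form with γ ≠ 0.  Comparing the coefficients of x², z², xz in
-- θ(ℓ) = ℓ·q forces α = 0 (the two-variable lemma), and likewise y², z², yz
-- force β = 0; so ℓ is proportional to z, contradicting pairwise
-- non-proportionality.  Hence all defining forms except z have γ = 0, and
-- then z∂z is a degree-1 logarithmic derivation which is not a multiple of
-- θ_E, contradicting the hypothesis.  I_xz and I_yz are treated in the same
-- way with y resp. x as the special coordinate.  Equality in K is not
-- decidable, so "γ = 0 or γ ≠ 0" is only used under a double negation; this
-- is harmless since all three conclusions are negations.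

open import Defs
open import Level using (Level)
open import Data.Nat using (ℕ)
open import Data.Fin using (Fin)
open import Data.Product using (Σ; _×_; _,_)
open import Relation.Nullary using (¬_)

import Data.Nat as ℕ
open import Data.Nat using (zero; suc; _≤_; _<_; z≤n; _∸_)
import Data.Nat.Properties as ℕₚ
open import Data.Fin using () renaming (zero to f0; suc to fs)
open import Data.Fin.Properties using () renaming (_≟_ to _≟ᶠ_)
open import Data.Product using (proj₁; proj₂; uncurry)
open import Data.Empty using (⊥; ⊥-elim)
open import Relation.Nullary using (yes; no; ¬¬-excluded-middle)
open import Relation.Binary.PropositionalEquality using (_≡_; _≢_; cong)
  renaming (refl to ≡-refl; sym to ≡-sym; trans to ≡-trans)

¬¬-∀-Fin : ∀ {a} n {P : Fin n → Set a} → (∀ i → ¬ ¬ P i) → ¬ ¬ (∀ i → P i)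
¬¬-∀-Fin zero    _   k = k (λ ())
¬¬-∀-Fin (suc n) ¬¬P k =
  ¬¬P f0 (λ p₀ → ¬¬-∀-Fin n (λ i → ¬¬P (fs i)) (λ ps → k (λ { f0 → p₀ ; (fs i) → ps i })))

module Theory {c ℓ : Level} (K : Field c ℓ) where
  open Field K hiding (zero)
  open FieldDefs K
  open import Relation.Binary.Reasoning.Setoid setoid
  open import Algebra.Properties.Group +-group using (x∙y⁻¹≈ε⇒x≈y; ∙-cancelʳ)
  open import Algebra.Properties.CommutativeSemigroup +-commutativeSemigroup using (interchange)
  open import Algebra.Properties.Ring ring using (-‿distribʳ-*)
  open import Algebra.Solver.Ring.NaturalCoefficients.Default commutativeSemiring
    using (solve; _:=_; _:+_; _:*_; con)

  ≡⇒≈ : ∀ {x y} → x ≡ y → x ≈ y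
  ≡⇒≈ ≡-refl = refl

  cancel-nonzero : ∀ {x y} → x * y ≈ 0# → ¬ (y ≈ 0#) → x ≈ 0#
  cancel-nonzero {x} {y} xy≈0 y≉0 with inverse y y≉0
  ... | y⁻¹ , yy⁻¹≈1 = begin
    x              ≈⟨ sym (*-identityʳ x) ⟩
    x * 1#         ≈⟨ *-cong refl (sym yy⁻¹≈1) ⟩
    x * (y * y⁻¹)  ≈⟨ sym (*-assoc x y y⁻¹) ⟩
    (x * y) * y⁻¹  ≈⟨ *-cong xy≈0 refl ⟩
    0# * y⁻¹       ≈⟨ zeroˡ y⁻¹ ⟩
    0#             ∎

  cancel-distinct : ∀ a S R → a * S ≈ a * R → ¬ (S ≈ R) → a ≈ 0#
  cancel-distinct a S R aS≈aR S≉R = cancel-nonzero a[S-R]≈0 (λ d≈0 → S≉R (x∙y⁻¹≈ε⇒x≈y S R d≈0))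
    where
    a[S-R]≈0 : a * (S - R) ≈ 0#
    a[S-R]≈0 = begin
      a * (S - R)        ≈⟨ distribˡ a S (- R) ⟩
      a * S + a * (- R)  ≈⟨ +-cong aS≈aR (sym (-‿distribʳ-* a R)) ⟩
      a * R - a * R      ≈⟨ -‿inverseʳ (a * R) ⟩
      0#                 ∎

  -- Let ℓ = αu + γw + ⋯ divide θ(ℓ) = ℓ·q, where θ acts
  -- on u, w as uL_u∂_u, wL_w∂_w.  The coefficients of u², w², uw give the
  -- three hypotheses below.  If L_u, L_w agree at u but differ at w, and
  -- γ ≠ 0, then α = 0: indeed αγ·(uw-equation) reduces to α²γ·L_u[w] = α²γ·L_w[w].
  two-variable : ∀ {α γ Luu Luw Lwu Lww qu qw} →
    α * Luu ≈ α * qu → γ * Lww ≈ γ * qw → α * Luw + γ * Lwu ≈ α * qw + γ * qu →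
    Lwu ≈ Luu → ¬ (Lww ≈ Luw) → ¬ (γ ≈ 0#) → ¬ ¬ (α ≈ 0#)
  two-variable {α} {γ} {Luu} {Luw} {Lwu} {Lww} {qu} {qw} uu ww uw Lwu≈Luu Lww≉Luw γ≉0 α≉0 =
    α≉0 (cancel-nonzero (cancel-nonzero α²γ≈0 γ≉0) α≉0)
    where
    regroup : ∀ a g A B → a * a * g * A + a * g * g * B ≈ a * g * (a * A + g * B)
    regroup = solve 4 (λ a g A B →
      a :* a :* g :* A :+ a :* g :* g :* B := a :* g :* (a :* A :+ g :* B)) refl
    distribute : ∀ a g A B → a * g * (a * A + g * B) ≈ a * a * (g * A) + g * g * (a * B)
    distribute = solve 4 (λ a g A B →
      a :* g :* (a :* A :+ g :* B) := a :* a :* (g :* A) :+ g :* g :* (a :* B)) refl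
    α²γ-equation : α * α * γ * Luw + α * γ * γ * Lwu ≈ α * α * γ * Lww + α * γ * γ * Lwu
    α²γ-equation = begin
      α * α * γ * Luw + α * γ * γ * Lwu    ≈⟨ regroup α γ Luw Lwu ⟩
      α * γ * (α * Luw + γ * Lwu)          ≈⟨ *-cong refl uw ⟩
      α * γ * (α * qw + γ * qu)            ≈⟨ distribute α γ qw qu ⟩
      α * α * (γ * qw) + γ * γ * (α * qu)  ≈⟨ +-cong (*-cong refl (sym ww)) (*-cong refl (sym uu)) ⟩
      α * α * (γ * Lww) + γ * γ * (α * Luu) ≈⟨ +-cong refl (*-cong refl (*-cong refl (sym Lwu≈Luu))) ⟩
      α * α * (γ * Lww) + γ * γ * (α * Lwu) ≈⟨ sym (distribute α γ Lww Lwu) ⟩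
      α * γ * (α * Lww + γ * Lwu)          ≈⟨ sym (regroup α γ Lww Lwu) ⟩
      α * α * γ * Lww + α * γ * γ * Lwu    ∎
    α²γ≈0 : α * α * γ ≈ 0#
    α²γ≈0 = cancel-distinct (α * α * γ) Luw Lww
              (∙-cancelʳ (α * γ * γ * Lwu) _ _ α²γ-equation) (λ e → Lww≉Luw (sym e))

  swap-sums : ∀ {a b x y} → a + b ≈ x + y → b + a ≈ y + x
  swap-sums a+b≈x+y = trans (+-comm _ _) (trans a+b≈x+y (+-comm _ _))

  Σ-cong : ∀ n {f g : ℕ → Carrier} → (∀ a → a ≤ n → f a ≈ g a) → Σ≤ n f ≈ Σ≤ n g
  Σ-cong zero    f≈g = f≈g 0 z≤n
  Σ-cong (suc n) f≈g = +-cong (Σ-cong n (λ a a≤n → f≈g a (ℕₚ.m≤n⇒m≤1+n a≤n))) (f≈g (suc n) ℕₚ.≤-refl)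

  Σ-cong′ : ∀ n {f g : ℕ → Carrier} → (∀ a → f a ≈ g a) → Σ≤ n f ≈ Σ≤ n g
  Σ-cong′ n f≈g = Σ-cong n (λ a _ → f≈g a)

  Σ-zero : ∀ n {f : ℕ → Carrier} → (∀ a → f a ≈ 0#) → Σ≤ n f ≈ 0#
  Σ-zero zero    f≈0 = f≈0 0
  Σ-zero (suc n) f≈0 = trans (+-cong (Σ-zero n f≈0) (f≈0 (suc n))) (+-identityˡ 0#)

  Σ-head : ∀ n (f : ℕ → Carrier) → Σ≤ (suc n) f ≈ f 0 + Σ≤ n (λ a → f (suc a))
  Σ-head zero    f = refl
  Σ-head (suc n) f = trans (+-cong (Σ-head n f) refl) (+-assoc _ _ _)

  Σ-only-head : ∀ n {f : ℕ → Carrier} → (∀ a → f (suc a) ≈ 0#) → Σ≤ n f ≈ f 0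
  Σ-only-head zero    _    = refl
  Σ-only-head (suc n) tail = trans (+-cong (Σ-only-head n tail) (tail n)) (+-identityʳ _)

  Σ-reverse : ∀ n (f : ℕ → Carrier) → Σ≤ n f ≈ Σ≤ n (λ a → f (n ∸ a))
  Σ-reverse zero    f = refl
  Σ-reverse (suc n) f = begin
    Σ≤ n f + f (suc n)                   ≈⟨ +-cong (Σ-reverse n f) refl ⟩
    Σ≤ n (λ a → f (n ∸ a)) + f (suc n)   ≈⟨ +-comm _ _ ⟩
    f (suc n) + Σ≤ n (λ a → f (n ∸ a))   ≈⟨ sym (Σ-head n (λ a → f (suc n ∸ a))) ⟩
    Σ≤ (suc n) (λ a → f (suc n ∸ a))     ∎

  Σ-antidiagonal : ∀ n (F : ℕ → ℕ → Carrier) → Σ≤ n (λ a → F a (n ∸ a)) ≈ Σ≤ n (λ a → F (n ∸ a) a)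
  Σ-antidiagonal n F = trans (Σ-reverse n (λ a → F a (n ∸ a)))
    (Σ-cong n (λ a a≤n → ≡⇒≈ (cong (F (n ∸ a)) (ℕₚ.m∸[m∸n]≡n a≤n))))

  Σ-+ : ∀ n (f g : ℕ → Carrier) → Σ≤ n (λ a → f a + g a) ≈ Σ≤ n f + Σ≤ n g
  Σ-+ zero    f g = refl
  Σ-+ (suc n) f g = trans (+-cong (Σ-+ n f g) refl) (interchange _ _ _ _)

  Σ-* : ∀ n x (f : ℕ → Carrier) → Σ≤ n (λ a → x * f a) ≈ x * Σ≤ n f
  Σ-* zero    x f = refl
  Σ-* (suc n) x f = trans (+-cong (Σ-* n x f) refl) (sym (distribˡ x _ _))

  Σ³ : ℕ → ℕ → ℕ → (ℕ → ℕ → ℕ → Carrier) → Carrier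
  Σ³ i j k F = Σ≤ i λ a → Σ≤ j λ b → Σ≤ k λ e → F a b e

  Σ³-cong : ∀ i j k {F G : ℕ → ℕ → ℕ → Carrier} → (∀ a b e → F a b e ≈ G a b e) → Σ³ i j k F ≈ Σ³ i j k G
  Σ³-cong i j k F≈G = Σ-cong′ i (λ a → Σ-cong′ j (λ b → Σ-cong′ k (λ e → F≈G a b e)))

  Σ³-zero : ∀ i j k {F : ℕ → ℕ → ℕ → Carrier} → (∀ a b e → F a b e ≈ 0#) → Σ³ i j k F ≈ 0#
  Σ³-zero i j k F≈0 = Σ-zero i (λ a → Σ-zero j (λ b → Σ-zero k (λ e → F≈0 a b e)))

  Σ³-+ : ∀ i j k (F G : ℕ → ℕ → ℕ → Carrier) →
         Σ³ i j k (λ a b e → F a b e + G a b e) ≈ Σ³ i j k F + Σ³ i j k G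
  Σ³-+ i j k F G =
    trans (Σ-cong′ i (λ a → trans (Σ-cong′ j (λ b → Σ-+ k _ _)) (Σ-+ j _ _))) (Σ-+ i _ _)

  Σ³-* : ∀ i j k x (F : ℕ → ℕ → ℕ → Carrier) → Σ³ i j k (λ a b e → x * F a b e) ≈ x * Σ³ i j k F
  Σ³-* i j k x F =
    trans (Σ-cong′ i (λ a → trans (Σ-cong′ j (λ b → Σ-* k x _)) (Σ-* j x _))) (Σ-* i x _)

  term : Series → Series → ℕ → ℕ → ℕ → ℕ → ℕ → ℕ → Carrier
  term f g i j k a b e = f a b e * g (i ∸ a) (j ∸ b) (k ∸ e)

  -- commutativity: reverse each of the three antidiagonal sums
  *ₚ-comm : ∀ f g → (f *ₚ g) ≈ₚ (g *ₚ f)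
  *ₚ-comm f g i j k = begin
    Σ³ i j k (λ a b e → f a b e * g (i ∸ a) (j ∸ b) (k ∸ e))
      ≈⟨ Σ-cong′ i (λ a → Σ-cong′ j (λ b → Σ-antidiagonal k (λ e e′ → f a b e * g (i ∸ a) (j ∸ b) e′))) ⟩
    Σ³ i j k (λ a b e → f a b (k ∸ e) * g (i ∸ a) (j ∸ b) e)
      ≈⟨ Σ-cong′ i (λ a → Σ-antidiagonal j (λ b b′ → Σ≤ k (λ e → f a b (k ∸ e) * g (i ∸ a) b′ e))) ⟩
    Σ³ i j k (λ a b e → f a (j ∸ b) (k ∸ e) * g (i ∸ a) b e)
      ≈⟨ Σ-antidiagonal i (λ a a′ → Σ≤ j (λ b → Σ≤ k (λ e → f a (j ∸ b) (k ∸ e) * g a′ b e))) ⟩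
    Σ³ i j k (λ a b e → f (i ∸ a) (j ∸ b) (k ∸ e) * g a b e)
      ≈⟨ Σ³-cong i j k (λ a b e → *-comm _ _) ⟩
    (g *ₚ f) i j k ∎

  *ₚ-congʳ : ∀ f {g g′} → g ≈ₚ g′ → (f *ₚ g) ≈ₚ (f *ₚ g′)
  *ₚ-congʳ f g≈g′ i j k = Σ³-cong i j k (λ a b e → *-cong refl (g≈g′ _ _ _))

  *ₚ-distribʳ : ∀ f g h → ((f +ₚ g) *ₚ h) ≈ₚ ((f *ₚ h) +ₚ (g *ₚ h))
  *ₚ-distribʳ f g h i j k =
    trans (Σ³-cong i j k (λ a b e → distribʳ _ _ _)) (Σ³-+ i j k (term f h i j k) (term g h i j k))

  *ₚ-scaleˡ : ∀ x f h → ((x ·ₚ f) *ₚ h) ≈ₚ (x ·ₚ (f *ₚ h))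
  *ₚ-scaleˡ x f h i j k =
    trans (Σ³-cong i j k (λ a b e → *-assoc _ _ _)) (Σ³-* i j k x (term f h i j k))

  *ₚ-zeroˡ : ∀ h → (0ₚ *ₚ h) ≈ₚ 0ₚ
  *ₚ-zeroˡ h i j k = Σ³-zero i j k (λ a b e → zeroˡ _)

  *ₚ-zeroʳ : ∀ f → (f *ₚ 0ₚ) ≈ₚ 0ₚ
  *ₚ-zeroʳ f i j k = Σ³-zero i j k (λ a b e → zeroʳ _)

  1ₚ : Series
  1ₚ zero zero zero = 1#
  1ₚ _    _    _    = 0#

  *ₚ-identityˡ : ∀ h → (1ₚ *ₚ h) ≈ₚ h
  *ₚ-identityˡ h i j k = begin
    (1ₚ *ₚ h) i j k
      ≈⟨ Σ-only-head i (λ a → Σ-zero j (λ b → Σ-zero k (λ e → zeroˡ _))) ⟩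
    Σ≤ j (λ b → Σ≤ k (λ e → 1ₚ 0 b e * h i (j ∸ b) (k ∸ e)))
      ≈⟨ Σ-only-head j (λ b → Σ-zero k (λ e → zeroˡ _)) ⟩
    Σ≤ k (λ e → 1ₚ 0 0 e * h i j (k ∸ e))   ≈⟨ Σ-only-head k (λ e → zeroˡ _) ⟩
    1# * h i j k                             ≈⟨ *-identityˡ _ ⟩
    h i j k                                  ∎

  sX sY sZ : Series → Series
  sX f zero    j k = 0#
  sX f (suc i) j k = f i j k
  sY f i zero    k = 0#
  sY f i (suc j) k = f i j k
  sZ f i j zero    = 0#
  sZ f i j (suc k) = f i j k

  X-mul : ∀ f → (X *ₚ f) ≈ₚ sX f
  X-mul f zero    j k = Σ-zero j (λ b → Σ-zero k (λ e → zeroˡ _))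
  X-mul f (suc i) j k = begin
    (X *ₚ f) (suc i) j k
      ≈⟨ Σ-head i (λ a → Σ≤ j (λ b → Σ≤ k (λ e → term X f (suc i) j k a b e))) ⟩
    Σ≤ j (λ b → Σ≤ k (λ e → X 0 b e * f (suc i) (j ∸ b) (k ∸ e)))
      + Σ³ i j k (λ a b e → X (suc a) b e * f (i ∸ a) (j ∸ b) (k ∸ e))
      ≈⟨ +-cong (Σ-zero j (λ b → Σ-zero k (λ e → zeroˡ _)))
                (Σ-only-head i (λ a → Σ-zero j (λ b → Σ-zero k (λ e → zeroˡ _)))) ⟩
    0# + Σ≤ j (λ b → Σ≤ k (λ e → X 1 b e * f i (j ∸ b) (k ∸ e)))
      ≈⟨ +-identityˡ _ ⟩
    Σ≤ j (λ b → Σ≤ k (λ e → X 1 b e * f i (j ∸ b) (k ∸ e)))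
      ≈⟨ Σ-only-head j (λ b → Σ-zero k (λ e → zeroˡ _)) ⟩
    Σ≤ k (λ e → X 1 0 e * f i j (k ∸ e))   ≈⟨ Σ-only-head k (λ e → zeroˡ _) ⟩
    1# * f i j k                           ≈⟨ *-identityˡ _ ⟩
    f i j k                                ∎

  Y-mul : ∀ f → (Y *ₚ f) ≈ₚ sY f
  Y-mul f i j k = trans (Σ-only-head i (λ a → Σ-zero j (λ b → Σ-zero k (λ e → zeroˡ _)))) (inner j)
    where
    inner : ∀ j → Σ≤ j (λ b → Σ≤ k (λ e → Y 0 b e * f i (j ∸ b) (k ∸ e))) ≈ sY f i j k
    inner zero    = Σ-zero k (λ e → zeroˡ _)
    inner (suc j) = begin
      Σ≤ (suc j) (λ b → Σ≤ k (λ e → Y 0 b e * f i (suc j ∸ b) (k ∸ e)))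
        ≈⟨ Σ-head j (λ b → Σ≤ k (λ e → Y 0 b e * f i (suc j ∸ b) (k ∸ e))) ⟩
      Σ≤ k (λ e → Y 0 0 e * f i (suc j) (k ∸ e))
        + Σ≤ j (λ b → Σ≤ k (λ e → Y 0 (suc b) e * f i (j ∸ b) (k ∸ e)))
        ≈⟨ +-cong (Σ-zero k (λ e → zeroˡ _)) (Σ-only-head j (λ b → Σ-zero k (λ e → zeroˡ _))) ⟩
      0# + Σ≤ k (λ e → Y 0 1 e * f i j (k ∸ e))   ≈⟨ +-identityˡ _ ⟩
      Σ≤ k (λ e → Y 0 1 e * f i j (k ∸ e))        ≈⟨ Σ-only-head k (λ e → zeroˡ _) ⟩
      1# * f i j k                                ≈⟨ *-identityˡ _ ⟩
      f i j k                                     ∎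

  Z-mul : ∀ f → (Z *ₚ f) ≈ₚ sZ f
  Z-mul f i j k = trans (Σ-only-head i (λ a → Σ-zero j (λ b → Σ-zero k (λ e → zeroˡ _))))
                   (trans (Σ-only-head j (λ b → Σ-zero k (λ e → zeroˡ _))) (inner k))
    where
    inner : ∀ k → Σ≤ k (λ e → Z 0 0 e * f i j (k ∸ e)) ≈ sZ f i j k
    inner zero    = zeroˡ _
    inner (suc k) = begin
      Σ≤ (suc k) (λ e → Z 0 0 e * f i j (suc k ∸ e))
        ≈⟨ Σ-head k (λ e → Z 0 0 e * f i j (suc k ∸ e)) ⟩
      0# * f i j (suc k) + Σ≤ k (λ e → Z 0 0 (suc e) * f i j (k ∸ e))
        ≈⟨ +-cong (zeroˡ _) (Σ-only-head k (λ e → zeroˡ _)) ⟩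
      0# + 1# * f i j k   ≈⟨ +-identityˡ _ ⟩
      1# * f i j k        ≈⟨ *-identityˡ _ ⟩
      f i j k             ∎

  tri : Carrier → Carrier → Carrier → Carrier → Carrier → Carrier → Carrier
  tri α β γ x y z = (α * x + β * y) + γ * z

  lin-mul : ∀ α β γ q i j k → (lin α β γ *ₚ q) i j k ≈ tri α β γ (sX q i j k) (sY q i j k) (sZ q i j k)
  lin-mul α β γ q i j k =
    trans (*ₚ-distribʳ ((α ·ₚ X) +ₚ (β ·ₚ Y)) (γ ·ₚ Z) q i j k)
      (+-cong (trans (*ₚ-distribʳ (α ·ₚ X) (β ·ₚ Y) q i j k)
                 (+-cong (trans (*ₚ-scaleˡ α X q i j k) (*-cong refl (X-mul q i j k)))
                         (trans (*ₚ-scaleˡ β Y q i j k) (*-cong refl (Y-mul q i j k)))))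
              (trans (*ₚ-scaleˡ γ Z q i j k) (*-cong refl (Z-mul q i j k))))

  tri-x : ∀ α β γ x → tri α β γ x 0# 0# ≈ α * x
  tri-x = solve 4 (λ α β γ x → (α :* x :+ β :* con 0) :+ γ :* con 0 := α :* x) refl
  tri-y : ∀ α β γ y → tri α β γ 0# y 0# ≈ β * y
  tri-y = solve 4 (λ α β γ y → (α :* con 0 :+ β :* y) :+ γ :* con 0 := β :* y) refl
  tri-z : ∀ α β γ z → tri α β γ 0# 0# z ≈ γ * z
  tri-z = solve 4 (λ α β γ z → (α :* con 0 :+ β :* con 0) :+ γ :* z := γ :* z) refl
  tri-xy : ∀ α β γ x y → tri α β γ x y 0# ≈ α * x + β * y
  tri-xy = solve 5 (λ α β γ x y → (α :* x :+ β :* y) :+ γ :* con 0 := α :* x :+ β :* y) refl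
  tri-xz : ∀ α β γ x z → tri α β γ x 0# z ≈ α * x + γ * z
  tri-xz = solve 5 (λ α β γ x z → (α :* x :+ β :* con 0) :+ γ :* z := α :* x :+ γ :* z) refl
  tri-yz : ∀ α β γ y z → tri α β γ 0# y z ≈ β * y + γ * z
  tri-yz = solve 5 (λ α β γ y z → (α :* con 0 :+ β :* y) :+ γ :* z := β :* y :+ γ :* z) refl

  lin-x : ∀ α β γ → lin α β γ 1 0 0 ≈ α
  lin-x α β γ = trans (tri-x α β γ 1#) (*-identityʳ α)
  lin-y : ∀ α β γ → lin α β γ 0 1 0 ≈ β
  lin-y α β γ = trans (tri-y α β γ 1#) (*-identityʳ β)
  lin-z : ∀ α β γ → lin α β γ 0 0 1 ≈ γ
  lin-z α β γ = trans (tri-z α β γ 1#) (*-identityʳ γ)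

  lin-cong : ∀ {α β γ α′ β′ γ′} → α ≈ α′ → β ≈ β′ → γ ≈ γ′ → lin α β γ ≈ₚ lin α′ β′ γ′
  lin-cong α≈ β≈ γ≈ i j k = +-cong (+-cong (*-cong α≈ refl) (*-cong β≈ refl)) (*-cong γ≈ refl)

  X-homog : IsHomog 1 X
  X-homog zero                j       k       _  = refl
  X-homog (suc zero)          zero    zero    ne = ⊥-elim (ne ≡-refl)
  X-homog (suc zero)          zero    (suc k) _  = refl
  X-homog (suc zero)          (suc j) k       _  = refl
  X-homog (suc (suc i))       j       k       _  = refl

  Y-homog : IsHomog 1 Y
  Y-homog (suc i) j                k       _  = refl
  Y-homog zero    zero             k       _  = refl
  Y-homog zero    (suc zero)       zero    ne = ⊥-elim (ne ≡-refl)
  Y-homog zero    (suc zero)       (suc k) _  = refl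
  Y-homog zero    (suc (suc j))    k       _  = refl

  Z-homog : IsHomog 1 Z
  Z-homog (suc i) j       k                _  = refl
  Z-homog zero    (suc j) k                _  = refl
  Z-homog zero    zero    zero             _  = refl
  Z-homog zero    zero    (suc zero)       ne = ⊥-elim (ne ≡-refl)
  Z-homog zero    zero    (suc (suc k))    _  = refl

  0ₚ-homog : ∀ d → IsHomog d 0ₚ
  0ₚ-homog d _ _ _ _ = refl

  lin-homog : ∀ α β γ → IsHomog 1 (lin α β γ)
  lin-homog α β γ i j k ne =
    trans (+-cong (+-cong (*-cong refl (X-homog i j k ne)) (*-cong refl (Y-homog i j k ne)))
                  (*-cong refl (Z-homog i j k ne)))
          (trans (tri-x α β γ 0#) (zeroʳ α))

  sub-homog : ∀ {d f g} → IsHomog d f → IsHomog d g → IsHomog d (f -ₚ g)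
  sub-homog f-homog g-homog i j k ne =
    trans (+-cong (f-homog i j k ne) (-‿cong (g-homog i j k ne))) (-‿inverseʳ 0#)

  X-mul-homog : ∀ {d f} → IsHomog d f → IsHomog (suc d) (X *ₚ f)
  X-mul-homog {f = f} f-homog zero    j k _  = X-mul f zero j k
  X-mul-homog {f = f} f-homog (suc i) j k ne =
    trans (X-mul f (suc i) j k) (f-homog i j k (λ e → ne (cong suc e)))

  Y-mul-homog : ∀ {d f} → IsHomog d f → IsHomog (suc d) (Y *ₚ f)
  Y-mul-homog {f = f} f-homog i zero    k _  = Y-mul f i zero k
  Y-mul-homog {f = f} f-homog i (suc j) k ne = trans (Y-mul f i (suc j) k)
    (f-homog i j k (λ e → ne (≡-trans (cong (ℕ._+ k) (ℕₚ.+-suc i j)) (cong suc e))))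

  Z-mul-homog : ∀ {d f} → IsHomog d f → IsHomog (suc d) (Z *ₚ f)
  Z-mul-homog {f = f} f-homog i j zero    _  = Z-mul f i j zero
  Z-mul-homog {f = f} f-homog i j (suc k) ne = trans (Z-mul f i j (suc k))
    (f-homog i j k (λ e → ne (≡-trans (ℕₚ.+-suc (i ℕ.+ j) k) (cong suc e))))

  homog⇒poly : ∀ {d f} → IsHomog d f → IsPoly f
  homog⇒poly {d} f-homog = d , λ i j k d<ijk → f-homog i j k (λ e → ℕₚ.<-irrefl (≡-sym e) d<ijk)

  0ₚ-poly : IsPoly 0ₚ
  0ₚ-poly = homog⇒poly (0ₚ-homog 0)

  1ₚ-poly : IsPoly 1ₚ
  1ₚ-poly = 0 , vanish
    where
    vanish : ∀ i j k → 0 < i ℕ.+ j ℕ.+ k → 1ₚ i j k ≈ 0#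
    vanish (suc i) j       k       _ = refl
    vanish zero    (suc j) k       _ = refl
    vanish zero    zero    (suc k) _ = refl

  generators-vanish : ∀ f g → IsPoly f → IsPoly g → IsZeroIdeal⟨ f , g ⟩ → (f ≈ₚ 0ₚ) × (g ≈ₚ 0ₚ)
  generators-vanish f g f-poly g-poly I≈0 =
      I≈0 f f-poly (1ₚ , 0ₚ , 1ₚ-poly , 0ₚ-poly ,
        λ i j k → sym (trans (+-cong (*ₚ-identityˡ f i j k) (*ₚ-zeroˡ g i j k)) (+-identityʳ _)))
    , I≈0 g g-poly (0ₚ , 1ₚ , 0ₚ-poly , 1ₚ-poly ,
        λ i j k → sym (trans (+-cong (*ₚ-zeroˡ f i j k) (*ₚ-identityˡ g i j k)) (+-identityˡ _)))

  sub≈0⇒≈ : ∀ {f g} → (f -ₚ g) ≈ₚ 0ₚ → f ≈ₚ g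
  sub≈0⇒≈ f-g≈0 i j k = x∙y⁻¹≈ε⇒x≈y _ _ (f-g≈0 i j k)

  ∣ₚ-zero : ∀ d {D} → D ≈ₚ 0ₚ → d ∣ₚ D
  ∣ₚ-zero d D≈0 = 0ₚ , 0ₚ-poly , λ i j k → trans (D≈0 i j k) (sym (*ₚ-zeroʳ d i j k))

  ∣ₚ-self : ∀ d {D} → D ≈ₚ d → d ∣ₚ D
  ∣ₚ-self d D≈d = 1ₚ , 1ₚ-poly , λ i j k →
    trans (D≈d i j k) (sym (trans (*ₚ-comm d 1ₚ i j k) (*ₚ-identityˡ d i j k)))

  log-coefficients : ∀ L₁ L₂ L₃ α β γ →
    lin α β γ ∣ₚ applyLin (X *ₚ L₁ , Y *ₚ L₂ , Z *ₚ L₃) (α , β , γ) →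
    Σ Series λ q → ∀ i j k → tri α β γ (sX L₁ i j k) (sY L₂ i j k) (sZ L₃ i j k)
                           ≈ tri α β γ (sX q i j k) (sY q i j k) (sZ q i j k)
  log-coefficients L₁ L₂ L₃ α β γ (q , _ , θℓ≈ℓq) = q , λ i j k →
    trans (sym (+-cong (+-cong (*-cong refl (X-mul L₁ i j k)) (*-cong refl (Y-mul L₂ i j k)))
                       (*-cong refl (Z-mul L₃ i j k))))
          (trans (θℓ≈ℓq i j k) (lin-mul α β γ q i j k))

  Euler-multiple : ∀ L₁ L₂ L₃ → L₂ ≈ₚ L₁ → L₃ ≈ₚ L₁ → (X *ₚ L₁ , Y *ₚ L₂ , Z *ₚ L₃) ≈ᵈ (L₁ ·ᵈ θE)
  Euler-multiple L₁ L₂ L₃ L₂≈L₁ L₃≈L₁ =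
      *ₚ-comm X L₁
    , (λ i j k → trans (*ₚ-congʳ Y L₂≈L₁ i j k) (*ₚ-comm Y L₁ i j k))
    , (λ i j k → trans (*ₚ-congʳ Z L₃≈L₁ i j k) (*ₚ-comm Z L₁ i j k))

  var : Fin 3 → Series
  var f0           = X
  var (fs f0)      = Y
  var (fs (fs f0)) = Z

  coeff : Fin 3 → Form → Carrier
  coeff f0           (α , _ , _) = α
  coeff (fs f0)      (_ , β , _) = β
  coeff (fs (fs f0)) (_ , _ , γ) = γ

  unitForm : Fin 3 → Form
  unitForm f0           = (1# , 0# , 0#)
  unitForm (fs f0)      = (0# , 1# , 0#)
  unitForm (fs (fs f0)) = (0# , 0# , 1#)

  coordDer : Fin 3 → Derivation
  coordDer f0           = (X , 0ₚ , 0ₚ)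
  coordDer (fs f0)      = (0ₚ , Y , 0ₚ)
  coordDer (fs (fs f0)) = (0ₚ , 0ₚ , Z)

  coordDer-apply : ∀ v φ → applyLin (coordDer v) φ ≈ₚ (coeff v φ ·ₚ var v)
  coordDer-apply f0           (α , β , γ) i j k = tri-x α β γ (X i j k)
  coordDer-apply (fs f0)      (α , β , γ) i j k = tri-y α β γ (Y i j k)
  coordDer-apply (fs (fs f0)) (α , β , γ) i j k = tri-z α β γ (Z i j k)

  coordDer-homog : ∀ v → HomogDer 1 (coordDer v)
  coordDer-homog f0           = X-homog , 0ₚ-homog 1 , 0ₚ-homog 1
  coordDer-homog (fs f0)      = 0ₚ-homog 1 , Y-homog , 0ₚ-homog 1
  coordDer-homog (fs (fs f0)) = 0ₚ-homog 1 , 0ₚ-homog 1 , Z-homog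

  -- x_v∂_v is not a multiple of θ_E: compare the coefficients of x_v in
  -- the v-th component and of x_u in another component u
  coordDer-not-Euler : ∀ v t → ¬ (coordDer v ≈ᵈ (t ⋆ᵈ θE))
  coordDer-not-Euler f0           t (e₁ , e₂ , _)  = 1≉0 (trans (e₁ 1 0 0) (sym (e₂ 0 1 0)))
  coordDer-not-Euler (fs f0)      t (e₁ , e₂ , _)  = 1≉0 (trans (e₂ 0 1 0) (sym (e₁ 1 0 0)))
  coordDer-not-Euler (fs (fs f0)) t (e₁ , _ , e₃)  = 1≉0 (trans (e₃ 0 0 1) (sym (e₁ 1 0 0)))

  coordDer-off-axis : ∀ v φ → coeff v φ ≈ 0# → formPoly φ ∣ₚ applyLin (coordDer v) φ
  coordDer-off-axis v φ φᵥ≈0 = ∣ₚ-zero (formPoly φ)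
    (λ i j k → trans (coordDer-apply v φ i j k) (trans (*-cong φᵥ≈0 refl) (zeroˡ _)))

  unitForm-poly : ∀ v → formPoly (unitForm v) ≈ₚ var v
  unitForm-poly f0           i j k = solve 3 (λ x y z →
    (con 1 :* x :+ con 0 :* y) :+ con 0 :* z := x) refl (X i j k) (Y i j k) (Z i j k)
  unitForm-poly (fs f0)      i j k = solve 3 (λ x y z →
    (con 0 :* x :+ con 1 :* y) :+ con 0 :* z := y) refl (X i j k) (Y i j k) (Z i j k)
  unitForm-poly (fs (fs f0)) i j k = solve 3 (λ x y z →
    (con 0 :* x :+ con 0 :* y) :+ con 1 :* z := z) refl (X i j k) (Y i j k) (Z i j k)

  coordDer-on-axis : ∀ v → formPoly (unitForm v) ∣ₚ applyLin (coordDer v) (unitForm v)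
  coordDer-on-axis v = ∣ₚ-self (formPoly (unitForm v)) (λ i j k → begin
    applyLin (coordDer v) (unitForm v) i j k  ≈⟨ coordDer-apply v (unitForm v) i j k ⟩
    coeff v (unitForm v) * var v i j k        ≈⟨ *-cong (unitForm-coeff v) refl ⟩
    1# * var v i j k                          ≈⟨ *-identityˡ _ ⟩
    var v i j k                               ≈⟨ sym (unitForm-poly v i j k) ⟩
    formPoly (unitForm v) i j k               ∎)
    where
    unitForm-coeff : ∀ v → coeff v (unitForm v) ≈ 1#
    unitForm-coeff f0           = refl
    unitForm-coeff (fs f0)      = refl
    unitForm-coeff (fs (fs f0)) = refl

  coordDer-axes : ∀ v u → formPoly (unitForm u) ∣ₚ applyLin (coordDer v) (unitForm u)
  coordDer-axes v u with u ≟ᶠ v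
  ... | yes ≡-refl = coordDer-on-axis v
  ... | no  u≢v    = coordDer-off-axis v (unitForm u) (other-coeff u v u≢v)
    where
    other-coeff : ∀ u v → u ≢ v → coeff v (unitForm u) ≈ 0#
    other-coeff f0           f0           u≢v = ⊥-elim (u≢v ≡-refl)
    other-coeff f0           (fs f0)      _   = refl
    other-coeff f0           (fs (fs f0)) _   = refl
    other-coeff (fs f0)      f0           _   = refl
    other-coeff (fs f0)      (fs f0)      u≢v = ⊥-elim (u≢v ≡-refl)
    other-coeff (fs f0)      (fs (fs f0)) _   = refl
    other-coeff (fs (fs f0)) f0           _   = refl
    other-coeff (fs (fs f0)) (fs f0)      _   = refl
    other-coeff (fs (fs f0)) (fs (fs f0)) u≢v = ⊥-elim (u≢v ≡-refl)

  module Arrangement (m : ℕ) (rest : Fin m → Form)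
    (deg1-Euler : ∀ θ′ → LogDer (forms rest) 1 θ′ → Σ Carrier λ t → θ′ ≈ᵈ (t ⋆ᵈ θE)) where

    coordDer-logarithmic : ∀ v → (∀ i → coeff v (rest i) ≈ 0#) → IsLogarithmic (forms rest) (coordDer v)
    coordDer-logarithmic v _        f0               = coordDer-axes v f0
    coordDer-logarithmic v _        (fs f0)          = coordDer-axes v (fs f0)
    coordDer-logarithmic v _        (fs (fs f0))     = coordDer-axes v (fs (fs f0))
    coordDer-logarithmic v rest-off (fs (fs (fs i))) = coordDer-off-axis v (rest i) (rest-off i)

    coordinate-involved : ∀ v → ¬ (∀ i → ¬ ¬ (coeff v (rest i) ≈ 0#))
    coordinate-involved v off = ¬¬-∀-Fin m off (λ rest-off →
      uncurry (coordDer-not-Euler v)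
              (deg1-Euler (coordDer v) (coordDer-homog v , coordDer-logarithmic v rest-off)))

  module QuadraticDerivation (m : ℕ) (rest : Fin m → Form)
     (non-proportional : PairwiseNonProportional (forms rest))
     (deg1-Euler : ∀ θ′ → LogDer (forms rest) 1 θ′ → Σ Carrier λ t → θ′ ≈ᵈ (t ⋆ᵈ θE))
     (b₁₁ b₂₁ b₃₁ b₁₂ b₂₂ b₃₂ b₁₃ b₂₃ b₃₃ : Carrier)
     (θ-log : LogDer (forms rest) 2 (X *ₚ lin b₁₁ b₂₁ b₃₁ , Y *ₚ lin b₁₂ b₂₂ b₃₂ , Z *ₚ lin b₁₃ b₂₃ b₃₃))
     (θ-not-Euler : ¬ (Σ Series λ L → IsLinearForm L ×
                       ((X *ₚ lin b₁₁ b₂₁ b₃₁ , Y *ₚ lin b₁₂ b₂₂ b₃₂ , Z *ₚ lin b₁₃ b₂₃ b₃₃) ≈ᵈ (L ·ᵈ θE))))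
     where
    open Arrangement m rest deg1-Euler

    L₁ L₂ L₃ : Series
    L₁ = lin b₁₁ b₂₁ b₃₁
    L₂ = lin b₁₂ b₂₂ b₃₂
    L₃ = lin b₁₃ b₂₃ b₃₃

    a₁ b₁ a₂ c₂ b₃ c₃ : Carrier
    a₁ = b₂₁ - b₂₂
    b₁ = b₁₂ - b₁₁
    a₂ = b₃₁ - b₃₃
    c₂ = b₁₃ - b₁₁
    b₃ = b₃₂ - b₃₃
    c₃ = b₂₃ - b₂₂

    L-not-all-equal : b₁₂ ≈ b₁₁ → b₂₂ ≈ b₂₁ → b₃₂ ≈ b₃₁ → b₁₃ ≈ b₁₁ → b₂₃ ≈ b₂₁ → b₃₃ ≈ b₃₁ → ⊥
    L-not-all-equal e₁₂ e₂₂ e₃₂ e₁₃ e₂₃ e₃₃ = θ-not-Euler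
      (L₁ , ((b₁₁ , b₂₁ , b₃₁) , λ _ _ _ → refl) ,
       Euler-multiple L₁ L₂ L₃ (lin-cong e₁₂ e₂₂ e₃₂) (lin-cong e₁₃ e₂₃ e₃₃))

    rest-off-axis : ∀ i v → ¬ Proportional (rest i) (unitForm v)
    rest-off-axis i f0           = non-proportional (fs (fs (fs i))) f0 (λ ())
    rest-off-axis i (fs f0)      = non-proportional (fs (fs (fs i))) (fs f0) (λ ())
    rest-off-axis i (fs (fs f0)) = non-proportional (fs (fs (fs i))) (fs (fs f0)) (λ ())

    -- θ(ℓ) = ℓ·q, for ℓ = αx + βy + γz and q = q_x x + q_y y + q_z z,
    -- compared at the six quadratic monomials
    record QuadraticRelations (α β γ : Carrier) : Set (c Level.⊔ ℓ) where
      field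
        qx qy qz : Carrier
        xx : α * b₁₁ ≈ α * qx
        yy : β * b₂₂ ≈ β * qy
        zz : γ * b₃₃ ≈ γ * qz
        xy : α * b₂₁ + β * b₁₂ ≈ α * qy + β * qx
        xz : α * b₃₁ + γ * b₁₃ ≈ α * qz + γ * qx
        yz : β * b₃₂ + γ * b₂₃ ≈ β * qz + γ * qy

    quadratic-relations : ∀ α β γ → lin α β γ ∣ₚ applyLin (X *ₚ L₁ , Y *ₚ L₂ , Z *ₚ L₃) (α , β , γ) →
                          QuadraticRelations α β γ
    quadratic-relations α β γ ℓ∣θℓ = record
      { qx = q 1 0 0 ; qy = q 0 1 0 ; qz = q 0 0 1
      ; xx = at 2 0 0 (trans (tri-x α β γ _) (*-cong refl (lin-x b₁₁ b₂₁ b₃₁))) (tri-x α β γ _)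
      ; yy = at 0 2 0 (trans (tri-y α β γ _) (*-cong refl (lin-y b₁₂ b₂₂ b₃₂))) (tri-y α β γ _)
      ; zz = at 0 0 2 (trans (tri-z α β γ _) (*-cong refl (lin-z b₁₃ b₂₃ b₃₃))) (tri-z α β γ _)
      ; xy = at 1 1 0 (trans (tri-xy α β γ _ _) (+-cong (*-cong refl (lin-y b₁₁ b₂₁ b₃₁))
                                                        (*-cong refl (lin-x b₁₂ b₂₂ b₃₂)))) (tri-xy α β γ _ _)
      ; xz = at 1 0 1 (trans (tri-xz α β γ _ _) (+-cong (*-cong refl (lin-z b₁₁ b₂₁ b₃₁))
                                                        (*-cong refl (lin-x b₁₃ b₂₃ b₃₃)))) (tri-xz α β γ _ _)
      ; yz = at 0 1 1 (trans (tri-yz α β γ _ _) (+-cong (*-cong refl (lin-z b₁₂ b₂₂ b₃₂))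
                                                        (*-cong refl (lin-y b₁₃ b₂₃ b₃₃)))) (tri-yz α β γ _ _)
      }
      where
      q : Series
      q = proj₁ (log-coefficients L₁ L₂ L₃ α β γ ℓ∣θℓ)
      at : ∀ {u w} i j k → tri α β γ (sX L₁ i j k) (sY L₂ i j k) (sZ L₃ i j k) ≈ u →
                           tri α β γ (sX q i j k) (sY q i j k) (sZ q i j k) ≈ w → u ≈ w
      at i j k θℓ≈u ℓq≈w = trans (sym θℓ≈u) (trans (proj₂ (log-coefficients L₁ L₂ L₃ α β γ ℓ∣θℓ) i j k) ℓq≈w)

    module RestForm (i : Fin m) where
      α β γ : Carrier
      α = coeff f0 (rest i)
      β = coeff (fs f0) (rest i)
      γ = coeff (fs (fs f0)) (rest i)
      open QuadraticRelations (quadratic-relations α β γ (proj₂ θ-log (fs (fs (fs i))))) public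

    -- If I_xy = 0 then θ = L₁θ_E + (b₃₃ - b₃₁)z²∂z: impossible.
    I_xy≢0 : ¬ IsZeroIdeal⟨ lin a₁ b₁ 0# , ((Y *ₚ lin a₂ 0# c₂) -ₚ (X *ₚ lin 0# b₃ c₃)) ⟩
    I_xy≢0 I≈0 = ¬¬-excluded-middle λ
      { (yes b₃₃≈b₃₁) → L-not-all-equal b₁₂≈b₁₁ (sym b₂₁≈b₂₂) (sym b₃₁≈b₃₂) b₁₃≈b₁₁
                                        (trans b₂₃≈b₂₂ (sym b₂₁≈b₂₂)) b₃₃≈b₃₁
      ; (no b₃₃≉b₃₁)  → coordinate-involved (fs (fs f0)) (λ i → z-free i b₃₃≉b₃₁) }
      where
      A B : Series
      A = lin a₂ 0# c₂
      B = lin 0# b₃ c₃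
      generators : (lin a₁ b₁ 0# ≈ₚ 0ₚ) × (((Y *ₚ A) -ₚ (X *ₚ B)) ≈ₚ 0ₚ)
      generators = generators-vanish _ _ (homog⇒poly (lin-homog _ _ _))
        (homog⇒poly (sub-homog (Y-mul-homog (lin-homog _ _ _)) (X-mul-homog (lin-homog _ _ _)))) I≈0
      yA≈xB : ∀ i j k → sY A i j k ≈ sX B i j k
      yA≈xB i j k = trans (sym (Y-mul A i j k)) (trans (sub≈0⇒≈ (proj₂ generators) i j k) (X-mul B i j k))
      b₂₁≈b₂₂ : b₂₁ ≈ b₂₂
      b₂₁≈b₂₂ = x∙y⁻¹≈ε⇒x≈y _ _ (trans (sym (lin-x a₁ b₁ 0#)) (proj₁ generators 1 0 0))
      b₁₂≈b₁₁ : b₁₂ ≈ b₁₁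
      b₁₂≈b₁₁ = x∙y⁻¹≈ε⇒x≈y _ _ (trans (sym (lin-y a₁ b₁ 0#)) (proj₁ generators 0 1 0))
      b₃₁≈b₃₂ : b₃₁ ≈ b₃₂
      b₃₁≈b₃₂ = ∙-cancelʳ (- b₃₃) _ _ (trans (sym (lin-x a₂ 0# c₂)) (trans (yA≈xB 1 1 0) (lin-y 0# b₃ c₃)))
      b₁₃≈b₁₁ : b₁₃ ≈ b₁₁
      b₁₃≈b₁₁ = x∙y⁻¹≈ε⇒x≈y _ _ (trans (sym (lin-z a₂ 0# c₂)) (yA≈xB 0 1 1))
      b₂₃≈b₂₂ : b₂₃ ≈ b₂₂
      b₂₃≈b₂₂ = x∙y⁻¹≈ε⇒x≈y _ _ (sym (trans (yA≈xB 1 0 1) (lin-z 0# b₃ c₃)))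
      -- a form of rest involving z would be proportional to z
      z-free : ∀ i → ¬ (b₃₃ ≈ b₃₁) → ¬ ¬ (coeff (fs (fs f0)) (rest i) ≈ 0#)
      z-free i b₃₃≉b₃₁ γ≉0 =
        two-variable xx zz xz b₁₃≈b₁₁ b₃₃≉b₃₁ γ≉0 λ α≈0 →
        two-variable yy zz yz b₂₃≈b₂₂ (λ e → b₃₃≉b₃₁ (trans e (sym b₃₁≈b₃₂))) γ≉0 λ β≈0 →
        rest-off-axis i (fs (fs f0)) (γ , trans α≈0 (sym (zeroʳ γ)) , trans β≈0 (sym (zeroʳ γ)) , sym (*-identityʳ γ))
        where open RestForm i

    -- If I_xz = 0 then θ = L₁θ_E + (b₂₂ - b₂₁)y²∂y: impossible.
    I_xz≢0 : ¬ IsZeroIdeal⟨ lin a₂ 0# c₂ , ((Z *ₚ lin a₁ b₁ 0#) -ₚ (X *ₚ lin 0# b₃ c₃)) ⟩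
    I_xz≢0 I≈0 = ¬¬-excluded-middle λ
      { (yes b₂₂≈b₂₁) → L-not-all-equal b₁₂≈b₁₁ b₂₂≈b₂₁ (trans b₃₂≈b₃₃ (sym b₃₁≈b₃₃)) b₁₃≈b₁₁
                                        (sym b₂₁≈b₂₃) (sym b₃₁≈b₃₃)
      ; (no b₂₂≉b₂₁)  → coordinate-involved (fs f0) (λ i → y-free i b₂₂≉b₂₁) }
      where
      A B : Series
      A = lin a₁ b₁ 0#
      B = lin 0# b₃ c₃
      generators : (lin a₂ 0# c₂ ≈ₚ 0ₚ) × (((Z *ₚ A) -ₚ (X *ₚ B)) ≈ₚ 0ₚ)
      generators = generators-vanish _ _ (homog⇒poly (lin-homog _ _ _))
        (homog⇒poly (sub-homog (Z-mul-homog (lin-homog _ _ _)) (X-mul-homog (lin-homog _ _ _)))) I≈0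
      zA≈xB : ∀ i j k → sZ A i j k ≈ sX B i j k
      zA≈xB i j k = trans (sym (Z-mul A i j k)) (trans (sub≈0⇒≈ (proj₂ generators) i j k) (X-mul B i j k))
      b₃₁≈b₃₃ : b₃₁ ≈ b₃₃
      b₃₁≈b₃₃ = x∙y⁻¹≈ε⇒x≈y _ _ (trans (sym (lin-x a₂ 0# c₂)) (proj₁ generators 1 0 0))
      b₁₃≈b₁₁ : b₁₃ ≈ b₁₁
      b₁₃≈b₁₁ = x∙y⁻¹≈ε⇒x≈y _ _ (trans (sym (lin-z a₂ 0# c₂)) (proj₁ generators 0 0 1))
      b₂₁≈b₂₃ : b₂₁ ≈ b₂₃
      b₂₁≈b₂₃ = ∙-cancelʳ (- b₂₂) _ _ (trans (sym (lin-x a₁ b₁ 0#)) (trans (zA≈xB 1 0 1) (lin-z 0# b₃ c₃)))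
      b₁₂≈b₁₁ : b₁₂ ≈ b₁₁
      b₁₂≈b₁₁ = x∙y⁻¹≈ε⇒x≈y _ _ (trans (sym (lin-y a₁ b₁ 0#)) (zA≈xB 0 1 1))
      b₃₂≈b₃₃ : b₃₂ ≈ b₃₃
      b₃₂≈b₃₃ = x∙y⁻¹≈ε⇒x≈y _ _ (sym (trans (zA≈xB 1 1 0) (lin-y 0# b₃ c₃)))
      -- a form of rest involving y would be proportional to y
      y-free : ∀ i → ¬ (b₂₂ ≈ b₂₁) → ¬ ¬ (coeff (fs f0) (rest i) ≈ 0#)
      y-free i b₂₂≉b₂₁ β≉0 =
        two-variable xx yy xy b₁₂≈b₁₁ b₂₂≉b₂₁ β≉0 λ α≈0 →
        two-variable zz yy (swap-sums yz) b₃₂≈b₃₃ (λ e → b₂₂≉b₂₁ (trans e (sym b₂₁≈b₂₃))) β≉0 λ γ≈0 →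
        rest-off-axis i (fs f0) (β , trans α≈0 (sym (zeroʳ β)) , sym (*-identityʳ β) , trans γ≈0 (sym (zeroʳ β)))
        where open RestForm i

    -- If I_yz = 0 then θ = L₂θ_E + (b₁₁ - b₁₂)x²∂x: impossible.
    I_yz≢0 : ¬ IsZeroIdeal⟨ lin 0# b₃ c₃ , ((Z *ₚ lin a₁ b₁ 0#) -ₚ (Y *ₚ lin a₂ 0# c₂)) ⟩
    I_yz≢0 I≈0 = ¬¬-excluded-middle λ
      { (yes b₁₁≈b₁₂) → L-not-all-equal (sym b₁₁≈b₁₂) (sym b₂₁≈b₂₂) (trans b₃₂≈b₃₃ (sym b₃₁≈b₃₃))
                                        (trans (sym b₁₂≈b₁₃) (sym b₁₁≈b₁₂)) (trans b₂₃≈b₂₂ (sym b₂₁≈b₂₂))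
                                        (sym b₃₁≈b₃₃)
      ; (no b₁₁≉b₁₂)  → coordinate-involved f0 (λ i → x-free i b₁₁≉b₁₂) }
      where
      A B : Series
      A = lin a₁ b₁ 0#
      B = lin a₂ 0# c₂
      generators : (lin 0# b₃ c₃ ≈ₚ 0ₚ) × (((Z *ₚ A) -ₚ (Y *ₚ B)) ≈ₚ 0ₚ)
      generators = generators-vanish _ _ (homog⇒poly (lin-homog _ _ _))
        (homog⇒poly (sub-homog (Z-mul-homog (lin-homog _ _ _)) (Y-mul-homog (lin-homog _ _ _)))) I≈0
      zA≈yB : ∀ i j k → sZ A i j k ≈ sY B i j k
      zA≈yB i j k = trans (sym (Z-mul A i j k)) (trans (sub≈0⇒≈ (proj₂ generators) i j k) (Y-mul B i j k))
      b₃₂≈b₃₃ : b₃₂ ≈ b₃₃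
      b₃₂≈b₃₃ = x∙y⁻¹≈ε⇒x≈y _ _ (trans (sym (lin-y 0# b₃ c₃)) (proj₁ generators 0 1 0))
      b₂₃≈b₂₂ : b₂₃ ≈ b₂₂
      b₂₃≈b₂₂ = x∙y⁻¹≈ε⇒x≈y _ _ (trans (sym (lin-z 0# b₃ c₃)) (proj₁ generators 0 0 1))
      b₂₁≈b₂₂ : b₂₁ ≈ b₂₂
      b₂₁≈b₂₂ = x∙y⁻¹≈ε⇒x≈y _ _ (trans (sym (lin-x a₁ b₁ 0#)) (zA≈yB 1 0 1))
      b₁₂≈b₁₃ : b₁₂ ≈ b₁₃
      b₁₂≈b₁₃ = ∙-cancelʳ (- b₁₁) _ _ (trans (sym (lin-y a₁ b₁ 0#)) (trans (zA≈yB 0 1 1) (lin-z a₂ 0# c₂)))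
      b₃₁≈b₃₃ : b₃₁ ≈ b₃₃
      b₃₁≈b₃₃ = x∙y⁻¹≈ε⇒x≈y _ _ (sym (trans (zA≈yB 1 1 0) (lin-x a₂ 0# c₂)))
      -- a form of rest involving x would be proportional to x
      x-free : ∀ i → ¬ (b₁₁ ≈ b₁₂) → ¬ ¬ (coeff f0 (rest i) ≈ 0#)
      x-free i b₁₁≉b₁₂ α≉0 =
        two-variable yy xx (swap-sums xy) b₂₁≈b₂₂ b₁₁≉b₁₂ α≉0 λ β≈0 →
        two-variable zz xx (swap-sums xz) b₃₁≈b₃₃ (λ e → b₁₁≉b₁₂ (trans e (sym b₁₂≈b₁₃))) α≉0 λ γ≈0 →
        rest-off-axis i f0 (α , sym (*-identityʳ α) , trans β≈0 (sym (zeroʳ α)) , trans γ≈0 (sym (zeroʳ α)))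
        where open RestForm i

lemma2p3 : ∀ {c ℓ : Level} (K : Field c ℓ) →
    let open Field K
        open FieldDefs K
    in CharZero →
    (m : ℕ) (rest : Fin m → Form) →
    PairwiseNonProportional (forms rest) →
    (∀ θ′ → LogDer (forms rest) 1 θ′ → Σ Carrier λ t → θ′ ≈ᵈ (t ⋆ᵈ θE)) →
    (b₁₁ b₂₁ b₃₁ b₁₂ b₂₂ b₃₂ b₁₃ b₂₃ b₃₃ : Carrier) →
    let L₁ = lin b₁₁ b₂₁ b₃₁
        L₂ = lin b₁₂ b₂₂ b₃₂
        L₃ = lin b₁₃ b₂₃ b₃₃
        θ : Derivation
        θ = (X *ₚ L₁ , Y *ₚ L₂ , Z *ₚ L₃)
        a₁ = b₂₁ - b₂₂
        b₁ = b₁₂ - b₁₁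
        a₂ = b₃₁ - b₃₃
        c₂ = b₁₃ - b₁₁
        b₃ = b₃₂ - b₃₃
        c₃ = b₂₃ - b₂₂
    in LogDer (forms rest) 2 θ →
    ¬ (Σ Series λ L → IsLinearForm L × (θ ≈ᵈ (L ·ᵈ θE))) →
    ¬ (Σ Series λ D → NonConstant D × (D ∣ₚ (X *ₚ L₁)) × (D ∣ₚ (Y *ₚ L₂)) × (D ∣ₚ (Z *ₚ L₃))) →
    ¬ IsZeroIdeal⟨ lin a₁ b₁ 0# , ((Y *ₚ lin a₂ 0# c₂) -ₚ (X *ₚ lin 0# b₃ c₃)) ⟩
    × ¬ IsZeroIdeal⟨ lin a₂ 0# c₂ , ((Z *ₚ lin a₁ b₁ 0#) -ₚ (X *ₚ lin 0# b₃ c₃)) ⟩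
    × ¬ IsZeroIdeal⟨ lin 0# b₃ c₃ , ((Z *ₚ lin a₁ b₁ 0#) -ₚ (Y *ₚ lin a₂ 0# c₂)) ⟩
lemma2p3 K _ m rest non-proportional deg1-Euler b₁₁ b₂₁ b₃₁ b₁₂ b₂₂ b₃₂ b₁₃ b₂₃ b₃₃ θ-log θ-not-Euler _ =
  I_xy≢0 , I_xz≢0 , I_yz≢0
  where
  open Theory.QuadraticDerivation K m rest non-proportional deg1-Euler
         b₁₁ b₂₁ b₃₁ b₁₂ b₂₂ b₃₂ b₁₃ b₂₃ b₃₃ θ-log θ-not-Euler
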